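{- For positive integers $n_1,\ldots,n_{d+1}$, the polynomial $$F_{(n_1,\ldots, n_{d+ 1})}(\mathbf{x}^{(1)}; \ldots; \mathbf{x}^{(d)}) = \sum_{\pi \in \mathcal{P}(n_1,\ldots, n_{d+1})}\ \prod_{(i_1,\ldots, i_{d+1}) \in \mathrm{Cor}(\pi)} x^{(1)}_{i_1} \cdots x^{(d)}_{i_d}$$ is quasisymmetric in each set of variables $\mathbf{x}^{(1)},\ldots,\mathbf{x}^{(d)}$ independently (i.e., for each $m\in[d]$ it is quasisymmetric in $\mathbf{x}^{(m)}$ as a polynomial with coefficients in the ring generated by the other variables).
   Context: A $d$-dimensional partition is an array $\pi=(\pi_{\mathbf{i}})_{\mathbf{i}\in\mathbb{Z}_+^d}$ of nonnegative integers with finitely many nonzero entries, weakly decreasing in each coordinate; $D(\pi)=\{(\mathbf{i},i)\in\mathbb{Z}_+^{d+1}:1\le i\le\pi_{\mathbf{i}}\}$; $\mathcal{P}(n_1,\ldots,n_{d+1})$ is the set of those with $D(\pi)\subseteq[n_1]\times\cdots\times[n_{d+1}]$. $\mathrm{Cor}(\pi)=\{\mathbf{i}\in D(\pi):\mathbf{i}+\mathbf{e}_\ell\notin D(\pi)\ \forall\ell\in[d]\}$. Variables $\mathbf{x}^{(k)}=(x^{(k)}_1,\ldots,x^{(k)}_{n_k})$. A polynomial $f$ is quasisymmetric in $(y_1,\ldots,y_n)$ if for all $1\le\ell_1<\cdots<\ell_k\le n$, $1\le j_1<\cdots<j_k\le n$, $a_1,\ldots,a_k\in\mathbb{Z}_+$,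 the coefficients of $y_{\ell_1}^{a_1}\cdots y_{\ell_k}^{a_k}$ and $y_{j_1}^{a_1}\cdots y_{j_k}^{a_k}$ in $f$ agree. -}

module Defs where

open import Data.Nat using (ℕ; zero; suc; _≤ᵇ_; _≡ᵇ_; _+_; _≤_; _<_)
import Data.Nat.Properties as ℕP
open import Data.Bool using (Bool; true; false; if_then_else_; _∧_; not)
open import Data.Fin using (Fin; inject₁; fromℕ; _≟_)
import Data.Fin as F
open import Data.List using (List; []; _∷_; map; concatMap; upTo; filterᵇ; length; allFin)
open import Data.Bool.ListAction using (all; and)
open import Data.Nat.ListAction using (sum)
open import Relation.Nullary using (yes; no)
open import Data.Vec using (Vec; lookup; updateAt; zipWith; toList)
import Data.Vec.Properties as VP
open import Data.Product using (_×_; _,_; proj₁; proj₂)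
open import Relation.Nullary.Decidable using (⌊_⌋)
open import Function using (_∘_)

range1 : ℕ → List ℕ
range1 m = map suc (upTo m)

-- A point of Z_+^d is a vector of d positive naturals (coordinate k = lookup i k).
Point : ℕ → Set
Point d = Vec ℕ d

boxPts : {d : ℕ} → (Fin d → ℕ) → List (Point d)
boxPts {zero}  b = Data.Vec.[] ∷ []
boxPts {suc d} b = concatMap (λ x → map (Data.Vec._∷_ x) (boxPts (b ∘ F.suc))) (range1 (b F.zero))

_≡ᴾ_ : {d : ℕ} → Point d → Point d → Bool
p ≡ᴾ q = ⌊ VP.≡-dec ℕP._≟_ p q ⌋

_≤ᴾ_ : {d : ℕ} → Point d → Point d → Bool
p ≤ᴾ q = and (toList (zipWith _≤ᵇ_ p q))

step : {d : ℕ} → Point d → Fin d → Point d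
step i ℓ = updateAt i ℓ suc

-- Shape data: n : Fin (suc d) → ℕ, i.e. (n_1,...,n_{d+1}).
-- The base box is [n_1] × ... × [n_d], the height bound is n_{d+1}.
baseBox : {d : ℕ} → (Fin (suc d) → ℕ) → List (Point d)
baseBox n = boxPts (n ∘ inject₁)

height : {d : ℕ} → (Fin (suc d) → ℕ) → ℕ
height {d} n = n (fromℕ d)

Array : ℕ → Set
Array d = Point d → ℕ

-- All arrays that vanish outside the list of points ps and take values in [0..N] on ps
-- (each such array appears exactly once, as the points in ps are distinct).
allArrays : {d : ℕ} → ℕ → List (Point d) → List (Array d)
allArrays N []       = (λ _ → 0) ∷ []
allArrays N (p ∷ ps) =
  concatMap (λ f → map (λ v → λ q → if q ≡ᴾ p then v else f q) (upTo (suc N)))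
            (allArrays N ps)

-- weakly decreasing in each coordinate: i ≤ j componentwise ⇒ π_j ≤ π_i
-- (only pairs inside the box need checking, since the arrays vanish outside it
--  and the complement of the box is an up-set in Z_+^d).
isPartitionᵇ : {d : ℕ} → List (Point d) → Array d → Bool
isPartitionᵇ B π = all (λ i → all (λ j → if i ≤ᴾ j then π j ≤ᵇ π i else true) B) B

-- 𝒫(n_1,...,n_{d+1}): the d-dimensional partitions with D(π) ⊆ [n_1]×...×[n_{d+1}],
-- listed without repetition.
partitions : {d : ℕ} → (Fin (suc d) → ℕ) → List (Array d)
partitions n = filterᵇ (isPartitionᵇ (baseBox n)) (allArrays (height n) (baseBox n))

inDᵇ : {d : ℕ} → Array d → Point d × ℕ → Bool
inDᵇ π (i , t) = (1 ≤ᵇ t) ∧ (t ≤ᵇ π i)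

-- Cor(π): cells of D(π) such that (i + e_ℓ , t) ∉ D(π) for all ℓ ∈ [d].
-- (For π ∈ 𝒫(n), D(π) lies in the box, so enumerating box cells is exhaustive.)
corners : {d : ℕ} → (Fin (suc d) → ℕ) → Array d → List (Point d × ℕ)
corners {d} n π =
  filterᵇ (λ c → inDᵇ π c ∧ all (λ ℓ → not (inDᵇ π (step (proj₁ c) ℓ , proj₂ c))) (allFin d))
          (concatMap (λ i → map (λ t → i , t) (range1 (height n))) (baseBox n))

-- A monomial in the variables x^{(k)}_j (k ∈ [d], j ∈ [n_k]) is given by its exponents:
-- e k j = exponent of x^{(k)}_{j}  (j is 1-based; only 1 ≤ j ≤ n_k matter).
Monomial : ℕ → Set
Monomial d = Fin d → ℕ → ℕ

cornerExp : {d : ℕ} → (Fin (suc d) → ℕ) → Array d → Fin d → ℕ → ℕ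
cornerExp n π k j = length (filterᵇ (λ c → lookup (proj₁ c) k ≡ᵇ j) (corners n π))

sameMonoᵇ : {d : ℕ} → (Fin (suc d) → ℕ) → Monomial d → Monomial d → Bool
sameMonoᵇ {d} n e e' =
  all (λ k → all (λ j → e k j ≡ᵇ e' k j) (range1 (n (inject₁ k)))) (allFin d)

-- Coefficient of the monomial e in F_{(n_1,...,n_{d+1})}:
-- the number of π ∈ 𝒫(n) whose corner monomial equals e.
coeffF : {d : ℕ} → (Fin (suc d) → ℕ) → Monomial d → ℕ
coeffF n e = length (filterᵇ (λ π → sameMonoᵇ n (cornerExp n π) e) (partitions n))

-- Exponent at position t of y_{ℓ_1}^{a_1} ⋯ y_{ℓ_r}^{a_r} (ℓ strictly increasing).
expAt : {r : ℕ} → (Fin r → ℕ) → (Fin r → ℕ) → ℕ → ℕ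
expAt {r} ℓ a t = sum (map (λ s → if ℓ s ≡ᵇ t then a s else 0) (allFin r))

setPart : {d r : ℕ} → Monomial d → Fin d → (Fin r → ℕ) → (Fin r → ℕ) → Monomial d
setPart g m ℓ a k t with k ≟ m
... | yes _ = expAt ℓ a t
... | no  _ = g k t

StrictIncIn : {r : ℕ} → ℕ → (Fin r → ℕ) → Set
StrictIncIn {r} N ℓ = (∀ (s s' : Fin r) → s F.< s' → ℓ s < ℓ s') × (∀ s → 1 ≤ ℓ s × ℓ s ≤ N)

module Submission where

-- Fix a direction m and a level q with 1 ≤ q < n_m.  If the corner monomial of a
-- partition π has no factor x^{(m)}_q, then π has no corner in the slice i_m = q, and
-- climbing inside D(π) from a cell of that slice above which π drops in direction m
-- would reach such a corner; so the slices q and q+1 of π coincide.  Replacing slice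
-- q+1 of such a π by slice q+2 moves the corners of slice q+1 to slice q, i.e. it
-- transposes x^{(m)}_q and x^{(m)}_{q+1} in the corner monomial, and replacing slice
-- q+1 by slice q undoes this.  Hence a coefficient does not change when an exponent
-- moves from x^{(m)}_{q+1} to an absent x^{(m)}_q, and such moves take every index
-- sequence ℓ₁ < ⋯ < ℓᵣ to 1, 2, …, r.

open import Defs
open import Data.Nat using (ℕ; zero; suc; pred; _+_; _≤_; _<_; _≤ᵇ_; _≡ᵇ_; _<?_; z≤n; s≤s)
import Data.Nat.Properties as ℕP
open import Data.Nat.ListAction using (sum)
open import Data.Bool using (Bool; true; false; T; T?; not; _∧_; if_then_else_)
open import Data.Bool.Properties using (T-∧; T-≡; ⇔→≡)
open import Data.Bool.ListAction using (all; and)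
open import Data.Fin using (Fin; inject₁; toℕ; fromℕ<)
import Data.Fin as F
import Data.Fin.Properties as FP
open import Data.List
  using (List; []; _∷_; _++_; map; length; upTo; allFin; concatMap; filterᵇ; cartesianProductWith; cartesianProduct)
open import Data.List.Properties using (length-removeAt′; map-cong; filter-≐; filter-some)
open import Data.List.Relation.Unary.All using (All; []; _∷_)
import Data.List.Relation.Unary.All as All
open import Data.List.Relation.Unary.All.Properties using (All¬⇒¬Any)
open import Data.List.Relation.Unary.Any using (Any; here; there; _─_)
import Data.List.Relation.Unary.Any as Any
import Data.List.Relation.Unary.Any.Properties as Any
open import Data.List.Relation.Unary.AllPairs using ([]; _∷_)
open import Data.List.Membership.Propositional using (_∈_; _∉_; find; lose)
open import Data.List.Membership.Propositional.Properties
  using (∈-map⁺; ∈-map⁻; ∈-upTo⁺; ∈-upTo⁻; ∈-allFin; ∈-concatMap⁻; ∈-filter⁺; ∈-filter⁻;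
         ∈-cartesianProductWith⁺; ∈-cartesianProductWith⁻; ∈-cartesianProduct⁺; ∈-cartesianProduct⁻)
import Data.List.Membership.DecPropositional as DecMembership
import Data.List.Membership.Setoid as SetoidMembership
import Data.List.Membership.Setoid.Properties as SetoidMembershipₚ
import Data.List.Relation.Unary.Unique.Propositional as UniqueP
import Data.List.Relation.Unary.Unique.Propositional.Properties as UniquePₚ
import Data.List.Relation.Unary.Unique.Setoid as UniqueS
import Data.List.Relation.Unary.Unique.Setoid.Properties as UniqueSₚ
open import Data.Product using (_×_; _,_; proj₁; proj₂)
open import Data.Sum using (_⊎_; inj₁; inj₂)
open import Data.Vec using (lookup; _[_]≔_)
import Data.Vec as V
import Data.Vec.Properties as VP
open import Function using (_∘_; _⇔_; mk⇔; Equivalence)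
open import Function.Definitions using (Congruent)
open import Relation.Binary.Bundles using (Setoid)
open import Relation.Binary.Definitions using (tri<; tri≈; tri>)
open import Relation.Binary.PropositionalEquality
  using (_≡_; _≢_; _≗_; refl; sym; trans; cong; cong₂; subst; subst₂; setoid; _→-setoid_; module ≡-Reasoning)
open import Relation.Nullary using (¬_; Dec; yes; no; contradiction)

open Equivalence using (to; from)

private
  variable
    A B C : Set

module _ {a ℓ} (S : Setoid a ℓ) where
  open Setoid S renaming (refl to ≈-refl; sym to ≈-sym; trans to ≈-trans)
  open SetoidMembership S using () renaming (_∈_ to _∈ₛ_)
  open UniqueS S using (Unique)

  private
    ∈-─ : ∀ {x y ys} (p : Any (x ≈_) ys) → y ∈ₛ ys → ¬ y ≈ x → y ∈ₛ (ys ─ p)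
    ∈-─ (here x≈z)  (here y≈z)  y≉x = contradiction (≈-trans y≈z (≈-sym x≈z)) y≉x
    ∈-─ (here _)    (there y∈)  _   = y∈
    ∈-─ (there _)   (here y≈z)  _   = here y≈z
    ∈-─ (there p)   (there y∈)  y≉x = there (∈-─ p y∈ y≉x)

  length-≤-of-injection : ∀ {xs ys} (f : Carrier → Carrier) → Unique xs →
    (∀ {x} → x ∈ₛ xs → f x ∈ₛ ys) →
    (∀ {x x′} → x ∈ₛ xs → x′ ∈ₛ xs → f x ≈ f x′ → x ≈ x′) →
    length xs ≤ length ys
  length-≤-of-injection {[]}     f _            _     _   = z≤n
  length-≤-of-injection {x ∷ xs} {ys} f (x∉ ∷ xs!) maps inj =
    subst (suc (length xs) ≤_) (sym (length-removeAt′ ys (Any.index fx∈)))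
      (s≤s (length-≤-of-injection f xs! maps′ (λ p q → inj (there p) (there q))))
    where
    fx∈ = maps (here ≈-refl)
    maps′ : ∀ {x′} → x′ ∈ₛ xs → f x′ ∈ₛ (ys ─ fx∈)
    maps′ x′∈ = ∈-─ fx∈ (maps (there x′∈))
      (λ fx′≈fx → SetoidMembershipₚ.All[≉]⇒∉ S x∉
                    (SetoidMembershipₚ.∈-resp-≈ S (inj (there x′∈) (here ≈-refl) fx′≈fx) x′∈))

  length-≡-of-inverses : ∀ {xs ys} (f g : Carrier → Carrier) → Unique xs → Unique ys →
    (∀ {x} → x ∈ₛ xs → f x ∈ₛ ys) → (∀ {y} → y ∈ₛ ys → g y ∈ₛ xs) →
    (∀ {x} → x ∈ₛ xs → g (f x) ≈ x) → (∀ {y} → y ∈ₛ ys → f (g y) ≈ y) →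
    Congruent _≈_ _≈_ f → Congruent _≈_ _≈_ g →
    length xs ≡ length ys
  length-≡-of-inverses f g xs! ys! f∈ g∈ gf fg f-cong g-cong = ℕP.≤-antisym
    (length-≤-of-injection f xs! f∈ (λ p q e → ≈-trans (≈-sym (gf p)) (≈-trans (g-cong e) (gf q))))
    (length-≤-of-injection g ys! g∈ (λ p q e → ≈-trans (≈-sym (fg p)) (≈-trans (f-cong e) (fg q))))

module _ {a b ℓ₁ ℓ₂} (S : Setoid a ℓ₁) (T : Setoid b ℓ₂) where
  open Setoid S using () renaming (_≈_ to _≈₁_)
  open SetoidMembership S using () renaming (_∈_ to _∈₁_)
  open SetoidMembership T using () renaming (_∈_ to _∈₂_)

  unique-concatMap : ∀ {xs} (f : Setoid.Carrier S → List (Setoid.Carrier T)) → UniqueS.Unique S xs →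
    (∀ {x} → x ∈₁ xs → UniqueS.Unique T (f x)) →
    (∀ {x x′ y} → x ∈₁ xs → x′ ∈₁ xs → y ∈₂ f x → y ∈₂ f x′ → x ≈₁ x′) →
    UniqueS.Unique T (concatMap f xs)
  unique-concatMap {[]}     f _          _   _        = UniqueS.[] {S = T}
  unique-concatMap {x ∷ xs} f (x∉ ∷ xs!) f! disjoint =
    UniqueSₚ.++⁺ T (f! (here (Setoid.refl S)))
      (unique-concatMap f xs! (λ p → f! (there p)) (λ p q → disjoint (there p) (there q)))
      fx-disjoint
    where
    fx-disjoint : ∀ {y} → ¬ (y ∈₂ f x × y ∈₂ concatMap f xs)
    fx-disjoint (y∈fx , y∈rest) with SetoidMembership.find S (SetoidMembershipₚ.∈-concatMap⁻ S T {xs = xs} y∈rest)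
    ... | x′ , x′∈ , y∈fx′ =
      SetoidMembershipₚ.All[≉]⇒∉ S x∉ (SetoidMembershipₚ.∈-resp-≈ S
        (Setoid.sym S (disjoint (here (Setoid.refl S)) (there x′∈) y∈fx y∈fx′)) x′∈)

T-all : (p : A → Bool) (xs : List A) → T (all p xs) ⇔ All (T ∘ p) xs
T-all p []       = mk⇔ (λ _ → []) (λ _ → _)
T-all p (x ∷ xs) = mk⇔
  (λ t → let (px , pxs) = to T-∧ t in px ∷ to (T-all p xs) pxs)
  (λ { (px ∷ pxs) → from T-∧ (px , from (T-all p xs) pxs) })

T-if : ∀ {b x} → T (if b then x else true) ⇔ (T b → T x)
T-if {true}  = mk⇔ (λ t _ → t) (λ f → f _)
T-if {false} = mk⇔ (λ _ ()) (λ _ → _)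

T-not : ∀ {x} → T (not x) ⇔ (¬ T x)
T-not {true}  = mk⇔ (λ ()) (λ ¬t → ¬t _)
T-not {false} = mk⇔ (λ _ ()) (λ _ → _)

¬T-unique : ∀ {x y} → ¬ T x → ¬ T y → x ≡ y
¬T-unique {true}           ¬x _  = contradiction _ ¬x
¬T-unique {false} {true}   _  ¬y = contradiction _ ¬y
¬T-unique {false} {false}  _  _  = refl

all-cong : {p q : A → Bool} → p ≗ q → ∀ xs → all p xs ≡ all q xs
all-cong p≗q xs = cong and (map-cong p≗q xs)

filterᵇ-cong : {p q : A → Bool} → p ≗ q → filterᵇ p ≗ filterᵇ q
filterᵇ-cong {p = p} {q} p≗q =
  filter-≐ (T? ∘ p) (T? ∘ q) ((λ {x} → subst T (p≗q x)) , (λ {x} → subst T (sym (p≗q x))))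

≡ᵇ-cong : ∀ {x y u v} → (x ≡ y ⇔ u ≡ v) → (x ≡ᵇ y) ≡ (u ≡ᵇ v)
≡ᵇ-cong {x} {y} {u} {v} x≡y⇔u≡v = ⇔→≡ {z = true} (mk⇔
  (λ e → to T-≡ (ℕP.≡⇒≡ᵇ u v (to x≡y⇔u≡v (ℕP.≡ᵇ⇒≡ x y (from T-≡ e)))))
  (λ e → to T-≡ (ℕP.≡⇒≡ᵇ x y (from x≡y⇔u≡v (ℕP.≡ᵇ⇒≡ u v (from T-≡ e))))))

concatMap-map : (f : A → B → C) (xs : List A) (ys : List B) →
  concatMap (λ x → map (f x) ys) xs ≡ cartesianProductWith f xs ys
concatMap-map f []       ys = refl
concatMap-map f (x ∷ xs) ys = cong (map (f x) ys ++_) (concatMap-map f xs ys)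

sum-map-≤ : (f g : A → ℕ) (xs : List A) → (∀ x → f x ≤ g x) → sum (map f xs) ≤ sum (map g xs)
sum-map-≤ f g []       f≤g = z≤n
sum-map-≤ f g (x ∷ xs) f≤g = ℕP.+-mono-≤ (f≤g x) (sum-map-≤ f g xs f≤g)

sum-map-< : (f g : A → ℕ) {xs : List A} {x : A} → x ∈ xs → (∀ y → f y ≤ g y) → f x < g x →
  sum (map f xs) < sum (map g xs)
sum-map-< f g {y ∷ xs} (here refl) f≤g fx<gx = ℕP.+-mono-<-≤ fx<gx (sum-map-≤ f g xs f≤g)
sum-map-< f g {y ∷ xs} (there x∈) f≤g fx<gx = ℕP.+-mono-≤-< (f≤g y) (sum-map-< f g x∈ f≤g fx<gx)

InBox : ∀ {d} → (Fin d → ℕ) → Point d → Set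
InBox b i = ∀ k → 1 ≤ lookup i k × lookup i k ≤ b k

infix 4 _≤ⱽ_
_≤ⱽ_ : ∀ {d} → Point d → Point d → Set
i ≤ⱽ j = ∀ k → lookup i k ≤ lookup j k

T-≤ᴾ : ∀ {d} (i j : Point d) → T (i ≤ᴾ j) ⇔ i ≤ⱽ j
T-≤ᴾ V.[]       V.[]       = mk⇔ (λ _ ()) (λ _ → _)
T-≤ᴾ (x V.∷ i) (y V.∷ j) = mk⇔
  (λ t → let (x≤y , i≤j) = to T-∧ t in
    λ { F.zero → ℕP.≤ᵇ⇒≤ x y x≤y ; (F.suc k) → to (T-≤ᴾ i j) i≤j k })
  (λ le → from T-∧ (ℕP.≤⇒≤ᵇ (le F.zero) , from (T-≤ᴾ i j) (le ∘ F.suc)))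

Positive : ∀ {d} → Point d → Set
Positive i = ∀ k → 1 ≤ lookup i k

V-sum-step : ∀ {d} (i : Point d) ℓ → V.sum (step i ℓ) ≡ suc (V.sum i)
V-sum-step (x V.∷ i) F.zero    = refl
V-sum-step (x V.∷ i) (F.suc ℓ) = trans (cong (x +_) (V-sum-step i ℓ)) (ℕP.+-suc x (V.sum i))

V-sum-mono : ∀ {d} {i j : Point d} → i ≤ⱽ j → V.sum i ≤ V.sum j
V-sum-mono {i = V.[]}     {V.[]}     _   = z≤n
V-sum-mono {i = x V.∷ i} {y V.∷ j} i≤j = ℕP.+-mono-≤ (i≤j F.zero) (V-sum-mono {i = i} {j} (i≤j ∘ F.suc))

step-≥ : ∀ {d} (i : Point d) ℓ → i ≤ⱽ step i ℓ
step-≥ i ℓ k with k FP.≟ ℓ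
... | yes refl rewrite VP.lookup∘updateAt k {suc} i = ℕP.n≤1+n _
... | no k≢ℓ   rewrite VP.lookup∘updateAt′ k ℓ {suc} k≢ℓ i = ℕP.≤-refl

∈-range1 : ∀ {m t} → t ∈ range1 m ⇔ (1 ≤ t × t ≤ m)
∈-range1 = mk⇔ from-range to-range
  where
  from-range : ∀ {m t} → t ∈ range1 m → 1 ≤ t × t ≤ m
  from-range t∈ with ∈-map⁻ suc t∈
  ... | _ , u∈ , refl = s≤s z≤n , ∈-upTo⁻ u∈
  to-range : ∀ {m t} → 1 ≤ t × t ≤ m → t ∈ range1 m
  to-range {t = suc t} (_ , t<m) = ∈-map⁺ suc (∈-upTo⁺ t<m)

range1-unique : ∀ m → UniqueP.Unique (range1 m)
range1-unique m = UniquePₚ.map⁺ ℕP.suc-injective (UniquePₚ.upTo⁺ m)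

boxPts-suc : ∀ {d} (b : Fin (suc d) → ℕ) →
  boxPts b ≡ cartesianProductWith V._∷_ (range1 (b F.zero)) (boxPts (b ∘ F.suc))
boxPts-suc b = concatMap-map V._∷_ (range1 (b F.zero)) (boxPts (b ∘ F.suc))

∈-boxPts : ∀ {d} (b : Fin d → ℕ) {i : Point d} → i ∈ boxPts b ⇔ InBox b i
∈-boxPts b = mk⇔ (from-box b) (to-box b)
  where
  from-box : ∀ {d} (b : Fin d → ℕ) {i : Point d} → i ∈ boxPts b → InBox b i
  from-box {zero}  b _  ()
  from-box {suc d} b i∈ rewrite boxPts-suc b
    with _ , _ , x∈ , is∈ , refl ← ∈-cartesianProductWith⁻ V._∷_ (range1 (b F.zero)) (boxPts (b ∘ F.suc)) i∈ =
    λ { F.zero → to ∈-range1 x∈ ; (F.suc k) → from-box (b ∘ F.suc) is∈ k }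
  to-box : ∀ {d} (b : Fin d → ℕ) {i : Point d} → InBox b i → i ∈ boxPts b
  to-box {zero}  b {V.[]} _ = here refl
  to-box {suc d} b {x V.∷ i} inBox rewrite boxPts-suc b =
    ∈-cartesianProductWith⁺ V._∷_ (from ∈-range1 (inBox F.zero))
                               (to-box (b ∘ F.suc) (inBox ∘ F.suc))

boxPts-unique : ∀ {d} (b : Fin d → ℕ) → UniqueP.Unique (boxPts b)
boxPts-unique {zero}  b = [] ∷ []
boxPts-unique {suc d} b rewrite boxPts-suc b =
  UniquePₚ.cartesianProductWith⁺ V._∷_ VP.∷-injective (range1-unique (b F.zero)) (boxPts-unique (b ∘ F.suc))

-- Arrays are functions, so lists of arrays are compared up to pointwise equality.
arraySetoid : ℕ → Setoid _ _
arraySetoid d = Point d →-setoid ℕ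

module _ {d : ℕ} where
  open SetoidMembership (arraySetoid d) public using () renaming (_∈_ to _∈ₐ_)
  open UniqueS (arraySetoid d) public using () renaming (Unique to Uniqueₐ)

  extend : Array d → Point d → ℕ → Array d
  extend f p v q = if q ≡ᴾ p then v else f q

  extend-≡ : (f : Array d) (p : Point d) (v : ℕ) → extend f p v p ≡ v
  extend-≡ f p v with VP.≡-dec ℕP._≟_ p p
  ... | yes _  = refl
  ... | no p≢p = contradiction refl p≢p

  extend-≢ : (f : Array d) (p : Point d) (v : ℕ) {q : Point d} → q ≢ p → extend f p v q ≡ f q
  extend-≢ f p v {q} q≢p with VP.≡-dec ℕP._≟_ q p
  ... | yes q≡p = contradiction q≡p q≢p
  ... | no _    = refl

  ArrayOn : ℕ → List (Point d) → Array d → Set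
  ArrayOn N ps π = (∀ i → π i ≤ N) × (∀ i → i ∉ ps → π i ≡ 0)

  ∈-allArrays⁻ : ∀ {N} ps {π} → π ∈ allArrays N ps → ArrayOn N ps π
  ∈-allArrays⁻ []       (here refl) = (λ _ → z≤n) , λ _ _ → refl
  ∈-allArrays⁻ {N} (p ∷ ps) π∈ with f , f∈ , π∈f ← find (∈-concatMap⁻ _ {xs = allArrays N ps} π∈)
                              with v , v∈ , refl ← ∈-map⁻ (extend f p) π∈f =
    bounded , vanishes
    where
    f-on = ∈-allArrays⁻ ps f∈
    bounded : ∀ i → extend f p v i ≤ N
    bounded i with VP.≡-dec ℕP._≟_ i p
    ... | yes refl = ℕP.≤-pred (∈-upTo⁻ v∈)
    ... | no _     = proj₁ f-on i
    vanishes : ∀ i → i ∉ p ∷ ps → extend f p v i ≡ 0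
    vanishes i i∉ = trans (extend-≢ f p v (i∉ ∘ here)) (proj₂ f-on i (i∉ ∘ there))

  ArrayOn-resp : ∀ {N ps π π′} → π ≗ π′ → ArrayOn N ps π → ArrayOn N ps π′
  ArrayOn-resp {N} π≗π′ (bounded , vanishes) =
    (λ i → subst (_≤ N) (π≗π′ i) (bounded i)) , λ i i∉ → trans (sym (π≗π′ i)) (vanishes i i∉)

  ∈ₐ-allArrays⁻ : ∀ {N} ps {π} → π ∈ₐ allArrays N ps → ArrayOn N ps π
  ∈ₐ-allArrays⁻ ps π∈ with π′ , π′∈ , π≗π′ ← find π∈ =
    ArrayOn-resp (sym ∘ π≗π′) (∈-allArrays⁻ ps π′∈)

  extend-self : (f g : Array d) (p : Point d) → (∀ i → i ≢ p → g i ≡ f i) → f ≗ extend g p (f p)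
  extend-self f g p g≡f i with VP.≡-dec ℕP._≟_ i p
  ... | yes refl = refl
  ... | no i≢p   = sym (g≡f i i≢p)

  allArrays-complete : ∀ {N} ps {f} → ArrayOn N ps f → f ∈ₐ allArrays N ps
  allArrays-complete []       (_ , vanishes) = here λ i → vanishes i λ ()
  allArrays-complete {N} (p ∷ ps) {f} (bounded , vanishes) =
    SetoidMembershipₚ.∈-concatMap⁺ (arraySetoid d) (arraySetoid d)
      (Any.map (λ g≗h → Any.map⁺ (Any.map (λ { refl → f≗extend g≗h }) (∈-upTo⁺ (s≤s (bounded p)))))
               (allArrays-complete ps (bounded₀ , vanishes₀)))
    where
    f≗extend : ∀ {g} → extend f p 0 ≗ g → f ≗ extend g p (f p)
    f≗extend g≗ = extend-self f _ p (λ i i≢p → trans (sym (g≗ i)) (extend-≢ f p 0 i≢p))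
    bounded₀ : ∀ i → extend f p 0 i ≤ N
    bounded₀ i with VP.≡-dec ℕP._≟_ i p
    ... | yes _ = z≤n
    ... | no _  = bounded i
    vanishes₀ : ∀ i → i ∉ ps → extend f p 0 i ≡ 0
    vanishes₀ i i∉ with VP.≡-dec ℕP._≟_ i p
    ... | yes _  = refl
    ... | no i≢p = vanishes i λ { (here i≡p) → i≢p i≡p ; (there i∈) → i∉ i∈ }

  allArrays-unique : ∀ {N} ps → UniqueP.Unique ps → Uniqueₐ (allArrays N ps)
  allArrays-unique []       _           = [] ∷ []
  allArrays-unique {N} (p ∷ ps) (p∉ ∷ ps!) =
    unique-concatMap (arraySetoid d) (arraySetoid d) (λ f → map (extend f p) (upTo (suc N)))
      (allArrays-unique ps ps!)
      (λ {f} _ → UniqueSₚ.map⁺ (setoid ℕ) (arraySetoid d)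
                   (λ {v} {v′} e → trans (sym (extend-≡ f p v)) (trans (e p) (extend-≡ f p v′)))
                   (UniquePₚ.upTo⁺ (suc N)))
      disjoint
    where
    p∉ps : p ∉ ps
    p∉ps = All¬⇒¬Any p∉
    disjoint : ∀ {f f′ g} → f ∈ₐ allArrays N ps → f′ ∈ₐ allArrays N ps →
      g ∈ₐ map (extend f p) (upTo (suc N)) → g ∈ₐ map (extend f′ p) (upTo (suc N)) → f ≗ f′
    disjoint {f} {f′} f∈ f′∈ g∈ g∈′ i with VP.≡-dec ℕP._≟_ i p
    ... | yes refl = trans (proj₂ (∈ₐ-allArrays⁻ ps f∈) i p∉ps) (sym (proj₂ (∈ₐ-allArrays⁻ ps f′∈) i p∉ps))
    ... | no i≢p with _ , _ , g≗ ← find (Any.map⁻ g∈) | _ , _ , g≗′ ← find (Any.map⁻ g∈′) =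
      trans (sym (extend-≢ f p _ i≢p)) (trans (sym (g≗ i)) (trans (g≗′ i) (extend-≢ f′ p _ i≢p)))

module _ {d : ℕ} (n : Fin (suc d) → ℕ) where

  record IsPartition (π : Array d) : Set where
    field
      bounded  : ∀ i → π i ≤ height n
      vanishes : ∀ i → i ∉ baseBox n → π i ≡ 0
      antitone : ∀ {i j} → i ∈ baseBox n → j ∈ baseBox n → i ≤ⱽ j → π j ≤ π i

  T-isPartitionᵇ : (π : Array d) →
    T (isPartitionᵇ (baseBox n) π) ⇔ (∀ {i j} → i ∈ baseBox n → j ∈ baseBox n → i ≤ⱽ j → π j ≤ π i)
  T-isPartitionᵇ π = mk⇔
    (λ t {i} {j} i∈ j∈ i≤j → ℕP.≤ᵇ⇒≤ (π j) (π i)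
      (to T-if (All.lookup (to (T-all _ _) (All.lookup (to (T-all _ _) t) i∈)) j∈)
                          (from (T-≤ᴾ i j) i≤j)))
    (λ anti → from (T-all _ _) (All.tabulate λ {i} i∈ → from (T-all _ _) (All.tabulate λ {j} j∈ →
      from T-if (λ i≤ᴾj → ℕP.≤⇒≤ᵇ (anti i∈ j∈ (to (T-≤ᴾ i j) i≤ᴾj))))))

  isPartitionᵇ-cong : ∀ {π π′ : Array d} → π ≗ π′ → isPartitionᵇ (baseBox n) π ≡ isPartitionᵇ (baseBox n) π′
  isPartitionᵇ-cong π≗π′ = all-cong (λ i → all-cong (λ j →
    cong (if i ≤ᴾ j then_else true) (cong₂ _≤ᵇ_ (π≗π′ j) (π≗π′ i))) (baseBox n)) (baseBox n)

  private
    isPartitionᵇ-resp : ∀ {π π′ : Array d} → π ≗ π′ → T (isPartitionᵇ (baseBox n) π) → T (isPartitionᵇ (baseBox n) π′)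
    isPartitionᵇ-resp π≗π′ = subst T (isPartitionᵇ-cong π≗π′)

  ∈ₐ-partitions : ∀ {π} → π ∈ₐ partitions n ⇔ IsPartition π
  ∈ₐ-partitions {π} = mk⇔ ⇒isPartition isPartition⇒
    where
    ⇒isPartition : π ∈ₐ partitions n → IsPartition π
    ⇒isPartition π∈ = record { bounded = bounded ; vanishes = vanishes ; antitone = to (T-isPartitionᵇ π) part }
      where
      filtered = SetoidMembershipₚ.∈-filter⁻ (arraySetoid d) (T? ∘ isPartitionᵇ (baseBox n)) isPartitionᵇ-resp π∈
      part = proj₂ filtered
      bounded = proj₁ (∈ₐ-allArrays⁻ (baseBox n) (proj₁ filtered))
      vanishes = proj₂ (∈ₐ-allArrays⁻ (baseBox n) (proj₁ filtered))
    isPartition⇒ : IsPartition π → π ∈ₐ partitions n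
    isPartition⇒ isP = SetoidMembershipₚ.∈-filter⁺ (arraySetoid d) (T? ∘ isPartitionᵇ (baseBox n)) isPartitionᵇ-resp
      (allArrays-complete (baseBox n) (IsPartition.bounded isP , IsPartition.vanishes isP))
      (from (T-isPartitionᵇ π) (IsPartition.antitone isP))

  partitions-unique : Uniqueₐ (partitions n)
  partitions-unique = UniqueSₚ.filter⁺ (arraySetoid d) (T? ∘ isPartitionᵇ (baseBox n))
    (allArrays-unique (baseBox n) (boxPts-unique (n ∘ inject₁)))

module _ {d : ℕ} {n : Fin (suc d) → ℕ} where

  antitone⁺ : ∀ {π : Array d} → IsPartition n π → ∀ {i j} → Positive i → i ≤ⱽ j → π j ≤ π i
  antitone⁺ {π} isP {i} {j} i-pos i≤j with DecMembership._∈?_ (VP.≡-dec ℕP._≟_) j (baseBox n)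
  ... | no j∉  = subst (_≤ π i) (sym (IsPartition.vanishes isP j j∉)) z≤n
  ... | yes j∈ = IsPartition.antitone isP i∈ j∈ i≤j
    where
    i∈ : i ∈ baseBox n
    i∈ = from (∈-boxPts _) λ k → i-pos k , ℕP.≤-trans (i≤j k) (proj₂ (to (∈-boxPts _) j∈ k))

module _ {d : ℕ} where

  isCornerᵇ : Array d → Point d × ℕ → Bool
  isCornerᵇ π (i , t) = inDᵇ π (i , t) ∧ all (λ ℓ → not (inDᵇ π (step i ℓ , t))) (allFin d)

  cells : (Fin (suc d) → ℕ) → List (Point d × ℕ)
  cells n = concatMap (λ i → map (λ t → i , t) (range1 (height n))) (baseBox n)

  IsCorner : Array d → Point d → ℕ → Set
  IsCorner π i t = 1 ≤ t × t ≤ π i × (∀ ℓ → π (step i ℓ) < t)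

  T-inDᵇ : ∀ (π : Array d) i t → T (inDᵇ π (i , t)) ⇔ (1 ≤ t × t ≤ π i)
  T-inDᵇ π i t = mk⇔
    (λ x → let (1≤t , t≤πi) = to T-∧ x in ℕP.≤ᵇ⇒≤ 1 t 1≤t , ℕP.≤ᵇ⇒≤ t (π i) t≤πi)
    (λ (1≤t , t≤πi) → from T-∧ (ℕP.≤⇒≤ᵇ 1≤t , ℕP.≤⇒≤ᵇ t≤πi))

  T-isCornerᵇ : ∀ (π : Array d) i t → T (isCornerᵇ π (i , t)) ⇔ IsCorner π i t
  T-isCornerᵇ π i t = mk⇔
    (λ x → let (inD , above) = to T-∧ x ; (1≤t , t≤πi) = to (T-inDᵇ π i t) inD in
      1≤t , t≤πi , λ ℓ → ℕP.≰⇒> λ t≤ → to T-not (All.lookup (to (T-all _ (allFin d)) above) (∈-allFin ℓ))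
                                         (from (T-inDᵇ π (step i ℓ) t) (1≤t , t≤)))
    (λ (1≤t , t≤πi , above) → from T-∧ (from (T-inDᵇ π i t) (1≤t , t≤πi) ,
      from (T-all _ (allFin d)) (All.tabulate λ {ℓ} _ → from T-not
        λ inD → ℕP.<⇒≱ (above ℓ) (proj₂ (to (T-inDᵇ π (step i ℓ) t) inD)))))

  isCornerᵇ-cong : ∀ (π π′ : Array d) i i′ t → π i ≡ π′ i′ → (∀ ℓ → π (step i ℓ) ≡ π′ (step i′ ℓ)) →
    isCornerᵇ π (i , t) ≡ isCornerᵇ π′ (i′ , t)
  isCornerᵇ-cong π π′ i i′ t πi≡ step≡ = cong₂ _∧_ (cong (λ v → (1 ≤ᵇ t) ∧ (t ≤ᵇ v)) πi≡)
    (all-cong (λ ℓ → cong (λ v → not ((1 ≤ᵇ t) ∧ (t ≤ᵇ v))) (step≡ ℓ)) (allFin d))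

module _ {d : ℕ} {n : Fin (suc d) → ℕ} where

  support⊆baseBox : ∀ {π : Array d} → IsPartition n π → ∀ {i} → 1 ≤ π i → i ∈ baseBox n
  support⊆baseBox {π} isP {i} 1≤πi with DecMembership._∈?_ (VP.≡-dec ℕP._≟_) i (baseBox n)
  ... | yes i∈ = i∈
  ... | no i∉  = contradiction (subst (1 ≤_) (IsPartition.vanishes isP i i∉) 1≤πi) λ ()

  V-sum≤boxSum : ∀ {i} → i ∈ baseBox n → V.sum i ≤ V.sum (V.tabulate (n ∘ inject₁))
  V-sum≤boxSum {i} i∈ = V-sum-mono {i = i} {V.tabulate (n ∘ inject₁)} λ k →
    subst (lookup i k ≤_) (sym (VP.lookup∘tabulate _ k)) (proj₂ (to (∈-boxPts _) i∈ k))

  cells-cartesianProduct : cells n ≡ cartesianProduct (baseBox n) (range1 (height n))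
  cells-cartesianProduct = concatMap-map _,_ (baseBox n) (range1 (height n))

  ∈-cells : ∀ {c} → c ∈ cells n ⇔ (proj₁ c ∈ baseBox n × 1 ≤ proj₂ c × proj₂ c ≤ height n)
  ∈-cells = mk⇔
    (λ c∈ → let (i∈ , t∈) = ∈-cartesianProduct⁻ (baseBox n) _ (subst (_ ∈_) cells-cartesianProduct c∈) in
      i∈ , to ∈-range1 t∈)
    (λ (i∈ , 1≤t , t≤H) → subst (_ ∈_) (sym cells-cartesianProduct)
      (∈-cartesianProduct⁺ i∈ (from ∈-range1 (1≤t , t≤H))))

  corner∈corners : ∀ {π : Array d} → IsPartition n π → ∀ {i t} → IsCorner π i t → (i , t) ∈ corners n π
  corner∈corners {π} isP {i} {t} corner@(1≤t , t≤πi , _) =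
    ∈-filter⁺ (T? ∘ isCornerᵇ π)
      (from ∈-cells (support⊆baseBox isP (ℕP.≤-trans 1≤t t≤πi) , 1≤t ,
                                 ℕP.≤-trans t≤πi (IsPartition.bounded isP i)))
      (from (T-isCornerᵇ π i t) corner)

  cells-unique : UniqueP.Unique (cells n)
  cells-unique = subst UniqueP.Unique (sym cells-cartesianProduct)
    (UniquePₚ.cartesianProduct⁺ (boxPts-unique (n ∘ inject₁)) (range1-unique (height n)))

  cornersAt : Array d → Fin d → ℕ → List (Point d × ℕ)
  cornersAt π k t = filterᵇ (λ c → lookup (proj₁ c) k ≡ᵇ t) (corners n π)

  ∈-cornersAt : ∀ {π k t c} → c ∈ cornersAt π k t ⇔ (c ∈ cells n × T (isCornerᵇ π c) × lookup (proj₁ c) k ≡ t)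
  ∈-cornersAt {π} {k} {t} {c} = mk⇔
    (λ c∈ → let (c∈corners , at) = ∈-filter⁻ (T? ∘ λ c → lookup (proj₁ c) k ≡ᵇ t) c∈
                (c∈cells , corner) = ∈-filter⁻ (T? ∘ isCornerᵇ π) {xs = cells n} c∈corners in
      c∈cells , corner , ℕP.≡ᵇ⇒≡ _ _ at)
    (λ (c∈cells , corner , at) → ∈-filter⁺ (T? ∘ λ c → lookup (proj₁ c) k ≡ᵇ t)
      (∈-filter⁺ (T? ∘ isCornerᵇ π) c∈cells corner) (ℕP.≡⇒≡ᵇ _ _ at))

  cornersAt-unique : ∀ π k t → UniqueP.Unique (cornersAt π k t)
  cornersAt-unique π k t = UniquePₚ.filter⁺ _ (UniquePₚ.filter⁺ _ cells-unique)

module _ {d : ℕ} (n : Fin (suc d) → ℕ) where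

  cornerExp-cong : ∀ {π π′ : Array d} → π ≗ π′ → ∀ k j → cornerExp n π k j ≡ cornerExp n π′ k j
  cornerExp-cong {π} {π′} π≗π′ k j = cong (length ∘ filterᵇ (λ c → lookup (proj₁ c) k ≡ᵇ j))
    (filterᵇ-cong {p = isCornerᵇ π} {isCornerᵇ π′}
      (λ (i , t) → isCornerᵇ-cong π π′ i i t (π≗π′ i) (λ ℓ → π≗π′ (step i ℓ))) (cells n))

  SameMonomial : Monomial d → Monomial d → Set
  SameMonomial E e = ∀ k t → 1 ≤ t → t ≤ n (inject₁ k) → E k t ≡ e k t

  T-sameMonoᵇ : ∀ E e → T (sameMonoᵇ n E e) ⇔ SameMonomial E e
  T-sameMonoᵇ E e = mk⇔
    (λ x k t 1≤t t≤nk → ℕP.≡ᵇ⇒≡ (E k t) (e k t)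
       (All.lookup (to (T-all _ (range1 (n (inject₁ k)))) (All.lookup (to (T-all _ (allFin d)) x) (∈-allFin k)))
                   (from ∈-range1 (1≤t , t≤nk))))
    (λ same → from (T-all _ (allFin d)) (All.tabulate λ {k} _ →
       from (T-all _ (range1 (n (inject₁ k)))) (All.tabulate λ {t} t∈ →
         let (1≤t , t≤nk) = to ∈-range1 t∈ in ℕP.≡⇒≡ᵇ _ _ (same k t 1≤t t≤nk))))

  withMonomial : Monomial d → List (Array d)
  withMonomial e = filterᵇ (λ π → sameMonoᵇ n (cornerExp n π) e) (partitions n)

  private
    sameMonoᵇ-resp : ∀ e {π π′ : Array d} → π ≗ π′ →
      T (sameMonoᵇ n (cornerExp n π) e) → T (sameMonoᵇ n (cornerExp n π′) e)
    sameMonoᵇ-resp e π≗π′ = subst T (all-cong (λ k →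
      all-cong (λ t → cong (_≡ᵇ e k t) (cornerExp-cong π≗π′ k t)) (range1 (n (inject₁ k)))) (allFin d))

  ∈ₐ-withMonomial : ∀ e {π} → π ∈ₐ withMonomial e ⇔ (IsPartition n π × SameMonomial (cornerExp n π) e)
  ∈ₐ-withMonomial e {π} = mk⇔
    (λ π∈ → let (π∈parts , same) = SetoidMembershipₚ.∈-filter⁻ (arraySetoid d) _ (sameMonoᵇ-resp e) π∈ in
      to (∈ₐ-partitions n) π∈parts , to (T-sameMonoᵇ _ e) same)
    (λ (isP , same) → SetoidMembershipₚ.∈-filter⁺ (arraySetoid d) _ (sameMonoᵇ-resp e)
      (from (∈ₐ-partitions n) isP) (from (T-sameMonoᵇ _ e) same))

  withMonomial-unique : ∀ e → Uniqueₐ (withMonomial e)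
  withMonomial-unique e = UniqueSₚ.filter⁺ (arraySetoid d) _ (partitions-unique n)

coeffF-cong : ∀ {d} (n : Fin (suc d) → ℕ) {e e′ : Monomial d} → (∀ k t → e k t ≡ e′ k t) → coeffF n e ≡ coeffF n e′
coeffF-cong {d} n e≡e′ = cong length (filterᵇ-cong (λ π →
  all-cong (λ k → all-cong (λ t → cong (cornerExp n π k t ≡ᵇ_) (e≡e′ k t)) (range1 (n (inject₁ k)))) (allFin d))
  (partitions n))

redirect : ℕ → ℕ → ℕ → ℕ
redirect c v a with a ℕP.≟ c
... | yes _ = v
... | no  _ = a

redirect-≡ : ∀ c v → redirect c v c ≡ v
redirect-≡ c v with c ℕP.≟ c
... | yes _   = refl
... | no c≢c  = contradiction refl c≢c

redirect-≢ : ∀ c v {a} → a ≢ c → redirect c v a ≡ a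
redirect-≢ c v {a} a≢c with a ℕP.≟ c
... | yes a≡c = contradiction a≡c a≢c
... | no _    = refl

redirect-mono : ∀ {c v} → pred c ≤ v → v ≤ suc c → ∀ {a a′} → a ≤ a′ → redirect c v a ≤ redirect c v a′
redirect-mono {c} {v} c-1≤v v≤c+1 {a} {a′} a≤a′ with a ℕP.≟ c | a′ ℕP.≟ c
... | yes _   | yes _    = ℕP.≤-refl
... | yes a≡c | no a′≢c  = ℕP.≤-trans v≤c+1 (ℕP.≤∧≢⇒< (subst (_≤ a′) a≡c a≤a′) (a′≢c ∘ sym))
... | no a≢c  | yes a′≡c = ℕP.≤-trans (ℕP.<⇒≤pred (ℕP.≤∧≢⇒< (subst (a ≤_) a′≡c a≤a′) a≢c)) c-1≤v
... | no _    | no _     = a≤a′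

redirect-pos : ∀ {c v a} → 1 ≤ v → 1 ≤ a → 1 ≤ redirect c v a
redirect-pos {c} {v} {a} 1≤v 1≤a with a ℕP.≟ c
... | yes _ = 1≤v
... | no  _ = 1≤a

redirect-inRange : ∀ {c v a N} → 1 ≤ c → c ≤ N → 1 ≤ redirect c v a × redirect c v a ≤ N → 1 ≤ a × a ≤ N
redirect-inRange {c} {v} {a} 1≤c c≤N inRange with a ℕP.≟ c
... | yes a≡c = subst (λ x → 1 ≤ x × x ≤ _) (sym a≡c) (1≤c , c≤N)
... | no  _   = inRange

transpose : ℕ → ℕ → ℕ
transpose q a with a ℕP.≟ q
... | yes _ = suc q
... | no  _ = redirect (suc q) q a

transpose-≡ : ∀ q → transpose q q ≡ suc q
transpose-≡ q with q ℕP.≟ q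
... | yes _   = refl
... | no q≢q  = contradiction refl q≢q

transpose-suc : ∀ q → transpose q (suc q) ≡ q
transpose-suc q with suc q ℕP.≟ q
... | yes q+1≡q = contradiction q+1≡q (ℕP.1+n≢n)
... | no  _     = redirect-≡ (suc q) q

transpose-≢ : ∀ q {a} → a ≢ q → a ≢ suc q → transpose q a ≡ a
transpose-≢ q {a} a≢q a≢q+1 with a ℕP.≟ q
... | yes a≡q = contradiction a≡q a≢q
... | no  _   = redirect-≢ (suc q) q a≢q+1

transpose-involutive : ∀ q a → transpose q (transpose q a) ≡ a
transpose-involutive q a = by-cases (a ℕP.≟ q) (a ℕP.≟ suc q)
  where
  open ≡-Reasoning
  by-cases : Dec (a ≡ q) → Dec (a ≡ suc q) → transpose q (transpose q a) ≡ a
  by-cases (yes a≡q) _ = begin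
    transpose q (transpose q a)    ≡⟨ cong (transpose q ∘ transpose q) a≡q ⟩
    transpose q (transpose q q)    ≡⟨ cong (transpose q) (transpose-≡ q) ⟩
    transpose q (suc q)            ≡⟨ transpose-suc q ⟩
    q                              ≡⟨ sym a≡q ⟩
    a                              ∎
  by-cases (no _) (yes a≡q+1) = begin
    transpose q (transpose q a)       ≡⟨ cong (transpose q ∘ transpose q) a≡q+1 ⟩
    transpose q (transpose q (suc q)) ≡⟨ cong (transpose q) (transpose-suc q) ⟩
    transpose q q                     ≡⟨ transpose-≡ q ⟩
    suc q                             ≡⟨ sym a≡q+1 ⟩
    a                                 ∎
  by-cases (no a≢q) (no a≢q+1) = trans (cong (transpose q) (transpose-≢ q a≢q a≢q+1)) (transpose-≢ q a≢q a≢q+1)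

transpose-inRange : ∀ {q a N} → 1 ≤ q → suc q ≤ N → 1 ≤ a → a ≤ N → 1 ≤ transpose q a × transpose q a ≤ N
transpose-inRange {q} {a} {N} 1≤q q+1≤N 1≤a a≤N = by-cases (a ℕP.≟ q) (a ℕP.≟ suc q)
  where
  InRange = λ y → 1 ≤ y × y ≤ N
  by-cases : Dec (a ≡ q) → Dec (a ≡ suc q) → InRange (transpose q a)
  by-cases (yes a≡q) _ =
    subst InRange (sym (trans (cong (transpose q) a≡q) (transpose-≡ q))) (s≤s z≤n , q+1≤N)
  by-cases (no _) (yes a≡q+1) =
    subst InRange (sym (trans (cong (transpose q) a≡q+1) (transpose-suc q))) (1≤q , ℕP.≤-trans (ℕP.n≤1+n q) q+1≤N)
  by-cases (no a≢q) (no a≢q+1) = subst InRange (sym (transpose-≢ q a≢q a≢q+1)) (1≤a , a≤N)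

transpose-<-avoiding : ∀ q {x y} → x ≢ q → y ≢ q → x < y → transpose q x < transpose q y
transpose-<-avoiding q {x} {y} x≢q y≢q x<y = by-cases (x ℕP.≟ suc q) (y ℕP.≟ suc q)
  where
  by-cases : Dec (x ≡ suc q) → Dec (y ≡ suc q) → transpose q x < transpose q y
  by-cases (yes x≡q+1) (yes y≡q+1) = contradiction (trans x≡q+1 (sym y≡q+1)) (ℕP.<⇒≢ x<y)
  by-cases (yes x≡q+1) (no y≢q+1)  = subst₂ _<_ (sym (trans (cong (transpose q) x≡q+1) (transpose-suc q)))
    (sym (transpose-≢ q y≢q y≢q+1)) (ℕP.<-trans (ℕP.n<1+n q) (subst (_< y) x≡q+1 x<y))
  by-cases (no x≢q+1)  (yes y≡q+1) = subst₂ _<_ (sym (transpose-≢ q x≢q x≢q+1))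
    (sym (trans (cong (transpose q) y≡q+1) (transpose-suc q))) (ℕP.≤∧≢⇒< (ℕP.≤-pred (subst (x <_) y≡q+1 x<y)) x≢q)
  by-cases (no x≢q+1)  (no y≢q+1)  = subst₂ _<_ (sym (transpose-≢ q x≢q x≢q+1)) (sym (transpose-≢ q y≢q y≢q+1)) x<y

transpose-≤-avoiding : ∀ q {x} → x ≢ q → transpose q x ≤ x
transpose-≤-avoiding q {x} x≢q = by-cases (x ℕP.≟ suc q)
  where
  by-cases : Dec (x ≡ suc q) → transpose q x ≤ x
  by-cases (yes x≡q+1) = subst₂ _≤_ (sym (trans (cong (transpose q) x≡q+1) (transpose-suc q))) (sym x≡q+1) (ℕP.n≤1+n q)
  by-cases (no x≢q+1)  = ℕP.≤-reflexive (transpose-≢ q x≢q x≢q+1)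

module Slices {d : ℕ} (n : Fin (suc d) → ℕ) (m : Fin d) where

  infixl 9 _⟨_⟩
  _⟨_⟩ : Point d → ℕ → Point d
  i ⟨ a ⟩ = i [ m ]≔ a

  lookup-⟨⟩ : ∀ i a → lookup (i ⟨ a ⟩) m ≡ a
  lookup-⟨⟩ i a = VP.lookup∘updateAt m i

  lookup-⟨⟩-≢ : ∀ i a {k} → k ≢ m → lookup (i ⟨ a ⟩) k ≡ lookup i k
  lookup-⟨⟩-≢ i a k≢m = VP.lookup∘updateAt′ _ m k≢m i

  ⟨⟩-⟨⟩ : ∀ i a c → i ⟨ a ⟩ ⟨ c ⟩ ≡ i ⟨ c ⟩
  ⟨⟩-⟨⟩ i a c = VP.[]≔-idempotent i m

  ⟨lookup⟩ : ∀ i → i ⟨ lookup i m ⟩ ≡ i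
  ⟨lookup⟩ i = VP.[]≔-lookup i m

  step-⟨⟩ : ∀ i a → step (i ⟨ a ⟩) m ≡ i ⟨ suc a ⟩
  step-⟨⟩ i a = VP.updateAt-updateAt-local m i refl

  step-⟨⟩-≢ : ∀ i a {ℓ} → ℓ ≢ m → step (i ⟨ a ⟩) ℓ ≡ step i ℓ ⟨ a ⟩
  step-⟨⟩-≢ i a ℓ≢m = VP.updateAt-commutes _ m ℓ≢m i

  ⟨⟩-mono : ∀ {i j a a′} → i ≤ⱽ j → a ≤ a′ → i ⟨ a ⟩ ≤ⱽ j ⟨ a′ ⟩
  ⟨⟩-mono {i} {j} {a} {a′} i≤j a≤a′ k with k FP.≟ m
  ... | yes refl rewrite lookup-⟨⟩ i a | lookup-⟨⟩ j a′ = a≤a′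
  ... | no k≢m   rewrite lookup-⟨⟩-≢ i a k≢m | lookup-⟨⟩-≢ j a′ k≢m = i≤j k

  ⟨⟩-positive : ∀ {i a} → (∀ k → k ≢ m → 1 ≤ lookup i k) → 1 ≤ a → Positive (i ⟨ a ⟩)
  ⟨⟩-positive {i} {a} i-pos 1≤a k with k FP.≟ m
  ... | yes refl rewrite lookup-⟨⟩ i a = 1≤a
  ... | no k≢m   rewrite lookup-⟨⟩-≢ i a k≢m = i-pos k k≢m

  ⟨⟩-inBox : ∀ {i a a′} → 1 ≤ a′ → a′ ≤ n (inject₁ m) → InBox (n ∘ inject₁) (i ⟨ a ⟩) → InBox (n ∘ inject₁) (i ⟨ a′ ⟩)
  ⟨⟩-inBox {i} {a} {a′} 1≤a′ a′≤N inBox k with k FP.≟ m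
  ... | yes refl rewrite lookup-⟨⟩ i a′ = 1≤a′ , a′≤N
  ... | no k≢m   rewrite lookup-⟨⟩-≢ i a′ k≢m = subst (λ x → 1 ≤ x × x ≤ n (inject₁ k)) (lookup-⟨⟩-≢ i a k≢m) (inBox k)

  Flat : Array d → ℕ → Set
  Flat π a = ∀ i → π (i ⟨ suc a ⟩) ≡ π (i ⟨ a ⟩)

  reindex : (ℕ → ℕ) → Array d → Array d
  reindex h π i = π (i ⟨ h (lookup i m) ⟩)

  reindex-⟨⟩ : ∀ h π i a → reindex h π (i ⟨ a ⟩) ≡ π (i ⟨ h a ⟩)
  reindex-⟨⟩ h π i a = cong π (trans (cong (λ x → i ⟨ a ⟩ ⟨ h x ⟩) (lookup-⟨⟩ i a)) (⟨⟩-⟨⟩ i a (h a)))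

  reindex-isPartition : ∀ {h π} →
    (∀ {a a′} → a ≤ a′ → h a ≤ h a′) → (∀ {a} → 1 ≤ a → 1 ≤ h a) →
    (∀ {a} → 1 ≤ h a × h a ≤ n (inject₁ m) → 1 ≤ a × a ≤ n (inject₁ m)) →
    IsPartition n π → IsPartition n (reindex h π)
  reindex-isPartition {h} {π} h-mono h-pos h-inRange isP = record
    { bounded  = λ i → IsPartition.bounded isP _
    ; vanishes = λ i i∉ → IsPartition.vanishes isP _ (i∉ ∘ reflect i)
    ; antitone = λ {i} {j} i∈ j∈ i≤j → antitone⁺ isP
        (⟨⟩-positive {i} (λ k _ → proj₁ (inBox i∈ k)) (h-pos (proj₁ (inBox i∈ m))))
        (⟨⟩-mono {i} {j} i≤j (h-mono (i≤j m)))
    }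
    where
    inBox : ∀ {i} → i ∈ baseBox n → InBox (n ∘ inject₁) i
    inBox = to (∈-boxPts (n ∘ inject₁))
    reflect : ∀ i → i ⟨ h (lookup i m) ⟩ ∈ baseBox n → i ∈ baseBox n
    reflect i i′∈ = from (∈-boxPts (n ∘ inject₁))
      (subst (InBox (n ∘ inject₁)) (⟨lookup⟩ i)
        (⟨⟩-inBox {i} {h (lookup i m)} (proj₁ inRange) (proj₂ inRange) (inBox i′∈)))
      where
      inRange = h-inRange (subst (λ x → 1 ≤ x × x ≤ n (inject₁ m)) (lookup-⟨⟩ i _) (inBox i′∈ m))

  corner-flat : ∀ {π : Array d} i a t → π (i ⟨ suc a ⟩) ≡ π (i ⟨ a ⟩) → ¬ T (isCornerᵇ π (i ⟨ a ⟩ , t))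
  corner-flat {π} i a t flat corner with to (T-isCornerᵇ π (i ⟨ a ⟩) t) corner
  ... | _ , t≤πi , above =
    ℕP.<⇒≱ (subst (_< t) (trans (cong π (step-⟨⟩ i a)) flat) (above m)) t≤πi

  isCornerᵇ-⟨⟩ : ∀ (π π′ : Array d) i a a′ t →
    (∀ j → π (j ⟨ a ⟩) ≡ π′ (j ⟨ a′ ⟩)) → π (i ⟨ suc a ⟩) ≡ π′ (i ⟨ suc a′ ⟩) →
    isCornerᵇ π (i ⟨ a ⟩ , t) ≡ isCornerᵇ π′ (i ⟨ a′ ⟩ , t)
  isCornerᵇ-⟨⟩ π π′ i a a′ t slices above = isCornerᵇ-cong π π′ (i ⟨ a ⟩) (i ⟨ a′ ⟩) t (slices i) neighbours
    where
    neighbours : ∀ ℓ → π (step (i ⟨ a ⟩) ℓ) ≡ π′ (step (i ⟨ a′ ⟩) ℓ)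
    neighbours ℓ with ℓ FP.≟ m
    ... | yes refl rewrite step-⟨⟩ i a | step-⟨⟩ i a′ = above
    ... | no ℓ≢m   rewrite step-⟨⟩-≢ i a ℓ≢m | step-⟨⟩-≢ i a′ ℓ≢m = slices (step i ℓ)

  module _ {π : Array d} (isP : IsPartition n π) (s : ℕ) where

    private
      K : ℕ
      K = V.sum (V.tabulate (n ∘ inject₁))

    -- Climb from the cell (j ⟨ s ⟩ , t), above which π drops in direction m, in
    -- directions ℓ ≢ m while staying in D(π).  The climb stops at a corner, and the
    -- coordinate sum, which grows at each step and is bounded on the box, bounds its length.
    corner-in-slice : ∀ fuel {j t} → K ≤ V.sum (j ⟨ s ⟩) + fuel →
      1 ≤ t → t ≤ π (j ⟨ s ⟩) → π (j ⟨ suc s ⟩) < t →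
      Any (λ c → lookup (proj₁ c) m ≡ s) (corners n π)
    corner-in-slice fuel {j} {t} sum≤ 1≤t t≤πj below
      with FP.all? (λ ℓ → π (step (j ⟨ s ⟩) ℓ) <? t)
    ... | yes above = lose (corner∈corners isP (1≤t , t≤πj , above)) (lookup-⟨⟩ j s)
    ... | no ¬above with FP.¬∀⟶∃¬ d _ (λ ℓ → π (step (j ⟨ s ⟩) ℓ) <? t) ¬above
    ... | ℓ , ¬πℓ<t with ℓ FP.≟ m
    ...   | yes refl = contradiction (subst (_< t) (sym (cong π (step-⟨⟩ j s))) below) ¬πℓ<t
    ...   | no ℓ≢m   = climb fuel sum≤
      where
      j′ = step j ℓ
      step≡ : step (j ⟨ s ⟩) ℓ ≡ j′ ⟨ s ⟩
      step≡ = step-⟨⟩-≢ j s ℓ≢m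
      t≤πj′ : t ≤ π (j′ ⟨ s ⟩)
      t≤πj′ = subst (λ x → t ≤ π x) step≡ (ℕP.≮⇒≥ ¬πℓ<t)
      j∈ = support⊆baseBox isP (ℕP.≤-trans 1≤t t≤πj)
      j′∈ = support⊆baseBox isP (ℕP.≤-trans 1≤t t≤πj′)
      below′ : π (j′ ⟨ suc s ⟩) < t
      below′ = ℕP.≤-<-trans
        (antitone⁺ isP (⟨⟩-positive {j} (λ k k≢m → subst (1 ≤_) (lookup-⟨⟩-≢ j s k≢m) (proj₁ (to (∈-boxPts _) j∈ k))) (s≤s z≤n))
                       (⟨⟩-mono {j} {j′} (step-≥ j ℓ) ℕP.≤-refl))
        below
      climb : ∀ fuel → K ≤ V.sum (j ⟨ s ⟩) + fuel → Any (λ c → lookup (proj₁ c) m ≡ s) (corners n π)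
      climb zero    sum≤ = contradiction (V-sum≤boxSum {n = n} j′∈) (ℕP.<⇒≱ (begin-strict
        K                         ≤⟨ subst (K ≤_) (ℕP.+-identityʳ _) sum≤ ⟩
        V.sum (j ⟨ s ⟩)           <⟨ ℕP.n<1+n _ ⟩
        suc (V.sum (j ⟨ s ⟩))     ≡⟨ sym (V-sum-step (j ⟨ s ⟩) ℓ) ⟩
        V.sum (step (j ⟨ s ⟩) ℓ)  ≡⟨ cong V.sum step≡ ⟩
        V.sum (j′ ⟨ s ⟩)          ∎))
        where open ℕP.≤-Reasoning
      climb (suc fuel) sum≤ = corner-in-slice fuel {j′} (subst (K ≤_) (begin
        V.sum (j ⟨ s ⟩) + suc fuel      ≡⟨ ℕP.+-suc _ fuel ⟩
        suc (V.sum (j ⟨ s ⟩)) + fuel    ≡⟨ cong (_+ fuel) (sym (V-sum-step (j ⟨ s ⟩) ℓ)) ⟩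
        V.sum (step (j ⟨ s ⟩) ℓ) + fuel ≡⟨ cong (λ x → V.sum x + fuel) step≡ ⟩
        V.sum (j′ ⟨ s ⟩) + fuel         ∎) sum≤) 1≤t t≤πj′ below′
        where open ≡-Reasoning

    cornerExp≡0⇒flat : 1 ≤ s → s ≤ n (inject₁ m) → cornerExp n π m s ≡ 0 → Flat π s
    cornerExp≡0⇒flat 1≤s s≤N no-corner i
      with DecMembership._∈?_ (VP.≡-dec ℕP._≟_) (i ⟨ s ⟩) (baseBox n)
    ... | no i∉ = trans (IsPartition.vanishes isP _ i′∉) (sym (IsPartition.vanishes isP _ i∉))
      where
      i′∉ : i ⟨ suc s ⟩ ∉ baseBox n
      i′∉ i′∈ = i∉ (from (∈-boxPts _)
        (⟨⟩-inBox {i} {suc s} 1≤s s≤N (to (∈-boxPts _) i′∈)))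
    ... | yes i∈ = ℕP.≤-antisym ≤πi (ℕP.≮⇒≥ λ drop → ℕP.<⇒≢ (count>0 drop) (sym no-corner))
      where
      count>0 : π (i ⟨ suc s ⟩) < π (i ⟨ s ⟩) → 0 < cornerExp n π m s
      count>0 drop = filter-some (T? ∘ λ c → lookup (proj₁ c) m ≡ᵇ s) (Any.map (ℕP.≡⇒≡ᵇ _ _)
        (corner-in-slice K {i} (ℕP.m≤n+m K _) (ℕP.<-≤-trans (s≤s z≤n) drop) ℕP.≤-refl drop))
      ≤πi : π (i ⟨ suc s ⟩) ≤ π (i ⟨ s ⟩)
      ≤πi = antitone⁺ isP (λ k → proj₁ (to (∈-boxPts _) i∈ k)) (⟨⟩-mono {i} {i} (λ _ → ℕP.≤-refl) (ℕP.n≤1+n s))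

  reindex-∘ : ∀ h g (π : Array d) → reindex h (reindex g π) ≗ reindex (g ∘ h) π
  reindex-∘ h g π i = reindex-⟨⟩ g π i (h (lookup i m))

  reindex-≗ : ∀ h (π : Array d) → (∀ j a → π (j ⟨ h a ⟩) ≡ π (j ⟨ a ⟩)) → reindex h π ≗ π
  reindex-≗ h π same i = trans (same i (lookup i m)) (cong π (⟨lookup⟩ i))

  exponent≡0⇒flat : ∀ {π e s} → IsPartition n π → SameMonomial n (cornerExp n π) e →
    1 ≤ s → s ≤ n (inject₁ m) → e m s ≡ 0 → Flat π s
  exponent≡0⇒flat isP same 1≤s s≤N e-s≡0 =
    cornerExp≡0⇒flat isP _ 1≤s s≤N (trans (same m _ 1≤s s≤N) e-s≡0)

  Transposed : ℕ → Monomial d → Monomial d → Set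
  Transposed q e e′ = (∀ k → k ≢ m → ∀ t → e′ k t ≡ e k t) × (∀ t → e′ m t ≡ e m (transpose q t))

  module Shift (q : ℕ) (1≤q : 1 ≤ q) (q+1≤N : suc q ≤ n (inject₁ m)) where

    -- Φ π repeats slice q+2 and Ψ π repeats slice q in place of slice q+1, where the
    -- slices are taken in direction m; τ exchanges the slices q and q+1.
    φ ψ : ℕ → ℕ
    φ = redirect (suc q) (suc (suc q))
    ψ = redirect (suc q) q

    Φ Ψ : Array d → Array d
    Φ = reindex φ
    Ψ = reindex ψ

    τ : Point d → Point d
    τ i = i ⟨ transpose q (lookup i m) ⟩

    Φ-isPartition : ∀ {π} → IsPartition n π → IsPartition n (Φ π)
    Φ-isPartition = reindex-isPartition
      (redirect-mono (ℕP.m≤n⇒m≤1+n (ℕP.n≤1+n q)) ℕP.≤-refl) (redirect-pos (s≤s z≤n)) (redirect-inRange (s≤s z≤n) q+1≤N)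

    Ψ-isPartition : ∀ {π} → IsPartition n π → IsPartition n (Ψ π)
    Ψ-isPartition = reindex-isPartition
      (redirect-mono ℕP.≤-refl (ℕP.m≤n⇒m≤1+n (ℕP.n≤1+n q))) (redirect-pos 1≤q) (redirect-inRange (s≤s z≤n) q+1≤N)

    Ψ-flat : ∀ π → Flat (Ψ π) q
    Ψ-flat π i = begin
      Ψ π (i ⟨ suc q ⟩)    ≡⟨ reindex-⟨⟩ ψ π i (suc q) ⟩
      π (i ⟨ ψ (suc q) ⟩)  ≡⟨ cong (λ x → π (i ⟨ x ⟩)) (redirect-≡ (suc q) q) ⟩
      π (i ⟨ q ⟩)          ≡⟨ cong (λ x → π (i ⟨ x ⟩)) (redirect-≢ (suc q) q (ℕP.1+n≢n ∘ sym)) ⟨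
      π (i ⟨ ψ q ⟩)        ≡⟨ reindex-⟨⟩ ψ π i q ⟨
      Ψ π (i ⟨ q ⟩)        ∎
      where open ≡-Reasoning

    Ψ∘Φ≗id : ∀ {π} → Flat π q → Ψ (Φ π) ≗ π
    Ψ∘Φ≗id {π} flat i = trans (reindex-∘ ψ φ π i) (reindex-≗ (φ ∘ ψ) π same i)
      where
      same : ∀ j a → π (j ⟨ φ (ψ a) ⟩) ≡ π (j ⟨ a ⟩)
      same j a = by-cases (a ℕP.≟ suc q)
        where
        by-cases : Dec (a ≡ suc q) → π (j ⟨ φ (ψ a) ⟩) ≡ π (j ⟨ a ⟩)
        by-cases (yes refl) = begin
          π (j ⟨ φ (ψ (suc q)) ⟩)  ≡⟨ cong (λ x → π (j ⟨ φ x ⟩)) (redirect-≡ (suc q) q) ⟩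
          π (j ⟨ φ q ⟩)            ≡⟨ cong (λ x → π (j ⟨ x ⟩)) (redirect-≢ (suc q) _ (ℕP.1+n≢n ∘ sym)) ⟩
          π (j ⟨ q ⟩)              ≡⟨ flat j ⟨
          π (j ⟨ suc q ⟩)          ∎
          where open ≡-Reasoning
        by-cases (no a≢q+1) = cong (λ x → π (j ⟨ x ⟩))
          (trans (cong φ (redirect-≢ (suc q) q a≢q+1)) (redirect-≢ (suc q) _ a≢q+1))

    Φ∘Ψ≗id : ∀ {π} → Flat π (suc q) → Φ (Ψ π) ≗ π
    Φ∘Ψ≗id {π} flat i = trans (reindex-∘ φ ψ π i) (reindex-≗ (ψ ∘ φ) π same i)
      where
      same : ∀ j a → π (j ⟨ ψ (φ a) ⟩) ≡ π (j ⟨ a ⟩)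
      same j a = by-cases (a ℕP.≟ suc q)
        where
        by-cases : Dec (a ≡ suc q) → π (j ⟨ ψ (φ a) ⟩) ≡ π (j ⟨ a ⟩)
        by-cases (yes refl) = begin
          π (j ⟨ ψ (φ (suc q)) ⟩)   ≡⟨ cong (λ x → π (j ⟨ ψ x ⟩)) (redirect-≡ (suc q) _) ⟩
          π (j ⟨ ψ (suc (suc q)) ⟩) ≡⟨ cong (λ x → π (j ⟨ x ⟩)) (redirect-≢ (suc q) q ℕP.1+n≢n) ⟩
          π (j ⟨ suc (suc q) ⟩)     ≡⟨ flat j ⟩
          π (j ⟨ suc q ⟩)           ∎
          where open ≡-Reasoning
        by-cases (no a≢q+1) = cong (λ x → π (j ⟨ x ⟩))
          (trans (cong ψ (redirect-≢ (suc q) _ a≢q+1)) (redirect-≢ (suc q) q a≢q+1))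

    Φ-⟨⟩ : ∀ π i a → Φ π (i ⟨ a ⟩) ≡ π (i ⟨ φ a ⟩)
    Φ-⟨⟩ = reindex-⟨⟩ φ

    isCornerᵇ-Φ-⟨⟩ : ∀ {π} → Flat π q → ∀ i a t → isCornerᵇ (Φ π) (i ⟨ a ⟩ , t) ≡ isCornerᵇ π (i ⟨ transpose q a ⟩ , t)
    isCornerᵇ-Φ-⟨⟩ {π} flat i a t = by-cases (a ℕP.≟ q) (a ℕP.≟ suc q)
      where
      Goal = isCornerᵇ (Φ π) (i ⟨ a ⟩ , t) ≡ isCornerᵇ π (i ⟨ transpose q a ⟩ , t)
      by-cases : Dec (a ≡ q) → Dec (a ≡ suc q) → Goal
      by-cases (yes refl) _ = trans
        (isCornerᵇ-⟨⟩ (Φ π) π i q (suc q) t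
          (λ j → trans (Φ-⟨⟩ π j q)
            (trans (cong (λ x → π (j ⟨ x ⟩)) (redirect-≢ (suc q) _ (ℕP.1+n≢n ∘ sym))) (sym (flat j))))
          (trans (Φ-⟨⟩ π i (suc q)) (cong (λ x → π (i ⟨ x ⟩)) (redirect-≡ (suc q) _))))
        (cong (λ x → isCornerᵇ π (i ⟨ x ⟩ , t)) (sym (transpose-≡ q)))
      by-cases (no _) (yes refl) = ¬T-unique
        (corner-flat {Φ π} i (suc q) t (trans (Φ-⟨⟩ π i (suc (suc q)))
          (trans (cong (λ x → π (i ⟨ x ⟩)) (redirect-≢ (suc q) _ ℕP.1+n≢n))
                 (sym (trans (Φ-⟨⟩ π i (suc q)) (cong (λ x → π (i ⟨ x ⟩)) (redirect-≡ (suc q) _)))))))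
        (subst (λ x → ¬ T (isCornerᵇ π (i ⟨ x ⟩ , t))) (sym (transpose-suc q)) (corner-flat {π} i q t (flat i)))
      by-cases (no a≢q) (no a≢q+1) = trans
        (isCornerᵇ-⟨⟩ (Φ π) π i a a t
          (λ j → trans (Φ-⟨⟩ π j a) (cong (λ x → π (j ⟨ x ⟩)) (redirect-≢ (suc q) _ a≢q+1)))
          (trans (Φ-⟨⟩ π i (suc a)) (cong (λ x → π (i ⟨ x ⟩)) (redirect-≢ (suc q) _ (a≢q ∘ ℕP.suc-injective)))))
        (cong (λ x → isCornerᵇ π (i ⟨ x ⟩ , t)) (sym (transpose-≢ q a≢q a≢q+1)))

    isCornerᵇ-Φ : ∀ {π} → Flat π q → ∀ i t → isCornerᵇ (Φ π) (i , t) ≡ isCornerᵇ π (τ i , t)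
    isCornerᵇ-Φ {π} flat i t =
      subst (λ x → isCornerᵇ (Φ π) (x , t) ≡ isCornerᵇ π (τ i , t)) (⟨lookup⟩ i)
        (isCornerᵇ-Φ-⟨⟩ {π} flat i (lookup i m) t)

    τ-involutive : ∀ i → τ (τ i) ≡ i
    τ-involutive i = begin
      i ⟨ a′ ⟩ ⟨ transpose q (lookup (i ⟨ a′ ⟩) m) ⟩ ≡⟨ cong (λ x → i ⟨ a′ ⟩ ⟨ transpose q x ⟩) (lookup-⟨⟩ i a′) ⟩
      i ⟨ a′ ⟩ ⟨ transpose q a′ ⟩                     ≡⟨ ⟨⟩-⟨⟩ i a′ _ ⟩
      i ⟨ transpose q a′ ⟩                             ≡⟨ cong (i ⟨_⟩) (transpose-involutive q (lookup i m)) ⟩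
      i ⟨ lookup i m ⟩                                 ≡⟨ ⟨lookup⟩ i ⟩
      i                                                ∎
      where
      open ≡-Reasoning
      a′ = transpose q (lookup i m)

    τ-baseBox : ∀ {i} → i ∈ baseBox n → τ i ∈ baseBox n
    τ-baseBox {i} i∈ = from (∈-boxPts _)
      (⟨⟩-inBox {i} {lookup i m} (proj₁ inRange) (proj₂ inRange) (subst (InBox _) (sym (⟨lookup⟩ i)) inBox))
      where
      inBox = to (∈-boxPts _) i∈
      inRange = transpose-inRange 1≤q q+1≤N (proj₁ (inBox m)) (proj₂ (inBox m))

    cornerExp-Φ : ∀ {π} → Flat π q → ∀ k t t′ →
      (∀ i → lookup i k ≡ t → lookup (τ i) k ≡ t′) → (∀ i → lookup i k ≡ t′ → lookup (τ i) k ≡ t) →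
      cornerExp n (Φ π) k t ≡ cornerExp n π k t′
    cornerExp-Φ {π} flat k t t′ t⇒t′ t′⇒t =
      length-≡-of-inverses (setoid (Point d × ℕ)) τc τc
        (cornersAt-unique {n = n} (Φ π) k t) (cornersAt-unique {n = n} π k t′)
        (λ {c} c∈ → let (c∈cells , corner , at) = to (∈-cornersAt {n = n}) c∈ in
          from (∈-cornersAt {n = n})
            (τ-cells c∈cells , subst T (isCornerᵇ-Φ {π} flat (proj₁ c) (proj₂ c)) corner , t⇒t′ (proj₁ c) at))
        (λ {c} c∈ → let (c∈cells , corner , at) = to (∈-cornersAt {n = n}) c∈ in
          from (∈-cornersAt {n = n})
            (τ-cells c∈cells ,
             subst T (sym (trans (isCornerᵇ-Φ {π} flat (τ (proj₁ c)) (proj₂ c))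
                                 (cong (λ x → isCornerᵇ π (x , proj₂ c)) (τ-involutive (proj₁ c))))) corner ,
             t′⇒t (proj₁ c) at))
        (λ {c} _ → τc-involutive c) (λ {c} _ → τc-involutive c) (cong τc) (cong τc)
      where
      τc : Point d × ℕ → Point d × ℕ
      τc (i , u) = τ i , u
      τc-involutive : ∀ c → τc (τc c) ≡ c
      τc-involutive (i , u) = cong (_, u) (τ-involutive i)
      τ-cells : ∀ {c} → c ∈ cells n → τc c ∈ cells n
      τ-cells c∈ = let (i∈ , u-range) = to (∈-cells {n = n}) c∈ in
        from (∈-cells {n = n}) (τ-baseBox i∈ , u-range)

    cornerExp-Φ-m : ∀ {π} → Flat π q → ∀ t → cornerExp n (Φ π) m t ≡ cornerExp n π m (transpose q t)
    cornerExp-Φ-m flat t = cornerExp-Φ flat m t (transpose q t)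
      (λ i at → trans (lookup-⟨⟩ i _) (cong (transpose q) at))
      (λ i at → trans (lookup-⟨⟩ i _) (trans (cong (transpose q) at) (transpose-involutive q t)))

    cornerExp-Φ-≢ : ∀ {π} → Flat π q → ∀ {k} → k ≢ m → ∀ t → cornerExp n (Φ π) k t ≡ cornerExp n π k t
    cornerExp-Φ-≢ flat k≢m t = cornerExp-Φ flat _ t t
      (λ i at → trans (lookup-⟨⟩-≢ i _ k≢m) at) (λ i at → trans (lookup-⟨⟩-≢ i _ k≢m) at)

    Φ-sameMonomial : ∀ {π e e′} → Transposed q e e′ → Flat π q →
      SameMonomial n (cornerExp n π) e → SameMonomial n (cornerExp n (Φ π)) e′
    Φ-sameMonomial {π} {e} {e′} (other , at-m) flat same k t 1≤t t≤nk with k FP.≟ m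
    ... | no k≢m   = trans (cornerExp-Φ-≢ flat k≢m t) (trans (same k t 1≤t t≤nk) (sym (other k k≢m t)))
    ... | yes refl = begin
      cornerExp n (Φ π) m t              ≡⟨ cornerExp-Φ-m flat t ⟩
      cornerExp n π m (transpose q t)    ≡⟨ same m (transpose q t) (proj₁ inRange) (proj₂ inRange) ⟩
      e m (transpose q t)                ≡⟨ at-m t ⟨
      e′ m t                             ∎
      where
      open ≡-Reasoning
      inRange = transpose-inRange 1≤q q+1≤N 1≤t t≤nk

    Ψ-sameMonomial : ∀ {π e e′} → Transposed q e e′ → Flat π (suc q) →
      SameMonomial n (cornerExp n π) e′ → SameMonomial n (cornerExp n (Ψ π)) e
    Ψ-sameMonomial {π} {e} {e′} (other , at-m) flat same k t 1≤t t≤nk with k FP.≟ m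
    ... | no k≢m   = begin
      cornerExp n (Ψ π) k t      ≡⟨ cornerExp-Φ-≢ (Ψ-flat π) k≢m t ⟨
      cornerExp n (Φ (Ψ π)) k t  ≡⟨ cornerExp-cong n (Φ∘Ψ≗id flat) k t ⟩
      cornerExp n π k t          ≡⟨ same k t 1≤t t≤nk ⟩
      e′ k t                     ≡⟨ other k k≢m t ⟩
      e k t                      ∎
      where open ≡-Reasoning
    ... | yes refl = begin
      cornerExp n (Ψ π) m t                             ≡⟨ cong (cornerExp n (Ψ π) m) (transpose-involutive q t) ⟨
      cornerExp n (Ψ π) m (transpose q (transpose q t)) ≡⟨ cornerExp-Φ-m (Ψ-flat π) (transpose q t) ⟨
      cornerExp n (Φ (Ψ π)) m (transpose q t)           ≡⟨ cornerExp-cong n (Φ∘Ψ≗id flat) m (transpose q t) ⟩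
      cornerExp n π m (transpose q t)                   ≡⟨ same m (transpose q t) (proj₁ inRange) (proj₂ inRange) ⟩
      e′ m (transpose q t)                              ≡⟨ at-m (transpose q t) ⟩
      e m (transpose q (transpose q t))                 ≡⟨ cong (e m) (transpose-involutive q t) ⟩
      e m t                                             ∎
      where
      open ≡-Reasoning
      inRange = transpose-inRange 1≤q q+1≤N 1≤t t≤nk

    coeffF-transposed : ∀ {e e′} → Transposed q e e′ → e m q ≡ 0 → coeffF n e ≡ coeffF n e′
    coeffF-transposed {e} {e′} transposed e-q≡0 =
      length-≡-of-inverses (arraySetoid d) Φ Ψ (withMonomial-unique n e) (withMonomial-unique n e′)
        (λ π∈ → let (isP , same) = member π∈ in
          from (∈ₐ-withMonomial n e′)
            (Φ-isPartition isP , Φ-sameMonomial transposed (flat-q isP same) same))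
        (λ π∈ → let (isP , same) = member′ π∈ in
          from (∈ₐ-withMonomial n e)
            (Ψ-isPartition isP , Ψ-sameMonomial transposed (flat-q+1 isP same) same))
        (λ π∈ → let (isP , same) = member π∈ in Ψ∘Φ≗id (flat-q isP same))
        (λ π∈ → let (isP , same) = member′ π∈ in Φ∘Ψ≗id (flat-q+1 isP same))
        (λ π≗π′ i → π≗π′ _) (λ π≗π′ i → π≗π′ _)
      where
      member : ∀ {π} → π ∈ₐ withMonomial n e → IsPartition n π × SameMonomial n (cornerExp n π) e
      member = to (∈ₐ-withMonomial n e)
      member′ : ∀ {π} → π ∈ₐ withMonomial n e′ → IsPartition n π × SameMonomial n (cornerExp n π) e′
      member′ = to (∈ₐ-withMonomial n e′)
      flat-q : ∀ {π} → IsPartition n π → SameMonomial n (cornerExp n π) e → Flat π q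
      flat-q isP same = exponent≡0⇒flat isP same 1≤q (ℕP.≤-trans (ℕP.n≤1+n q) q+1≤N) e-q≡0
      flat-q+1 : ∀ {π} → IsPartition n π → SameMonomial n (cornerExp n π) e′ → Flat π (suc q)
      flat-q+1 isP same = exponent≡0⇒flat isP same (s≤s z≤n) q+1≤N
        (trans (proj₂ transposed (suc q)) (trans (cong (e m) (transpose-suc q)) e-q≡0))

module _ {r : ℕ} where

  StrictlyIncreasing : (Fin r → ℕ) → Set
  StrictlyIncreasing ℓ = ∀ s s′ → s F.< s′ → ℓ s < ℓ s′

  weight : (Fin r → ℕ) → ℕ
  weight ℓ = sum (map ℓ (allFin r))

  canonical : Fin r → ℕ
  canonical s = suc (toℕ s)

  record Gap (ℓ : Fin r → ℕ) : Set where
    field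
      q        : ℕ
      1≤q      : 1 ≤ q
      absent   : ∀ s → ℓ s ≢ q
      index    : Fin r
      at-index : ℓ index ≡ suc q

strictlyIncreasing-≥ : ∀ {r c} (ℓ : Fin r → ℕ) → StrictlyIncreasing ℓ → (∀ s → c ≤ ℓ s) → ∀ s → c + toℕ s ≤ ℓ s
strictlyIncreasing-≥ {c = c} ℓ inc c≤ F.zero    = subst (_≤ ℓ F.zero) (sym (ℕP.+-identityʳ c)) (c≤ F.zero)
strictlyIncreasing-≥ {c = c} ℓ inc c≤ (F.suc s) = subst (_≤ ℓ (F.suc s)) (sym (ℕP.+-suc c (toℕ s)))
  (strictlyIncreasing-≥ (ℓ ∘ F.suc) (λ s s′ s<s′ → inc (F.suc s) (F.suc s′) (s≤s s<s′))
    (λ s → ℕP.≤-<-trans (c≤ F.zero) (inc F.zero (F.suc s) (s≤s z≤n))) s)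

module _ {r N : ℕ} {ℓ : Fin r → ℕ} (inc : StrictIncIn N ℓ) where

  -- The first s₀ with ℓ s₀ ≢ s₀ + 1 has ℓ s₀ ≥ s₀ + 2, and ℓ skips the value ℓ s₀ ∸ 1.
  canonical-or-gap : (∀ s → ℓ s ≡ canonical s) ⊎ Gap ℓ
  canonical-or-gap with FP.all? (λ s → ℓ s ℕP.≟ canonical s)
  ... | yes all-canonical = inj₁ all-canonical
  ... | no ¬all-canonical
    with s₀ , ℓs₀≢ , below ← FP.¬∀⟶∃¬-smallest r _ (λ s → ℓ s ℕP.≟ canonical s) ¬all-canonical
    with suc q ← ℓ s₀ in ℓs₀≡
       | s₀+2≤ℓs₀ ← ℕP.≤∧≢⇒< (strictlyIncreasing-≥ ℓ (proj₁ inc) (proj₁ ∘ proj₂ inc) s₀) (ℓs₀≢ ∘ sym) =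
    inj₂ record { q = q ; 1≤q = ℕP.≤-trans (s≤s z≤n) (ℕP.≤-pred s₀+2≤ℓs₀) ; absent = absent
                ; index = s₀ ; at-index = ℓs₀≡ }
    where
    below′ : ∀ s → toℕ s < toℕ s₀ → ℓ s ≡ canonical s
    below′ s s<s₀ = subst (λ x → ℓ x ≡ canonical x) inject≡s (below (fromℕ< s<s₀))
      where inject≡s = FP.toℕ-injective (trans (FP.toℕ-inject (fromℕ< s<s₀)) (FP.toℕ-fromℕ< s<s₀))
    absent : ∀ s → ℓ s ≢ q
    absent s ℓs≡q with ℕP.<-cmp (toℕ s) (toℕ s₀)
    ... | tri< s<s₀ _ _ = ℕP.<-irrefl ℓs≡q (begin-strict
      ℓ s                 ≡⟨ below′ s s<s₀ ⟩
      suc (toℕ s)         ≤⟨ s<s₀ ⟩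
      toℕ s₀              <⟨ ℕP.≤-pred s₀+2≤ℓs₀ ⟩
      q                   ∎)
      where open ℕP.≤-Reasoning
    ... | tri≈ _ s≡s₀ _ =
      ℕP.1+n≢n (trans (sym ℓs₀≡) (trans (cong ℓ (sym (FP.toℕ-injective s≡s₀))) ℓs≡q))
    ... | tri> _ _ s₀<s =
      ℕP.<-asym (subst₂ _<_ ℓs₀≡ ℓs≡q (proj₁ inc s₀ s s₀<s)) (ℕP.n<1+n q)

  module _ (gap : Gap ℓ) where
    open Gap gap

    transpose-strictIncIn : StrictIncIn N (transpose q ∘ ℓ)
    transpose-strictIncIn =
      (λ s s′ s<s′ → transpose-<-avoiding q (absent s) (absent s′) (proj₁ inc s s′ s<s′)) ,
      λ s → transpose-inRange 1≤q q+1≤N (proj₁ (proj₂ inc s)) (proj₂ (proj₂ inc s))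
      where
      q+1≤N : suc q ≤ N
      q+1≤N = subst (_≤ N) at-index (proj₂ (proj₂ inc index))

    transpose-weight : weight (transpose q ∘ ℓ) < weight ℓ
    transpose-weight = sum-map-< (transpose q ∘ ℓ) ℓ (∈-allFin index) (λ s → transpose-≤-avoiding q (absent s))
      (subst₂ _<_ (sym (trans (cong (transpose q) at-index) (transpose-suc q))) (sym at-index) (ℕP.n<1+n q))

module _ {r : ℕ} (a : Fin r → ℕ) where

  expAt-cong : ∀ {ℓ ℓ′ : Fin r → ℕ} → ℓ ≗ ℓ′ → expAt ℓ a ≗ expAt ℓ′ a
  expAt-cong ℓ≗ℓ′ t = cong sum (map-cong (λ s → cong (λ x → if x ≡ᵇ t then a s else 0) (ℓ≗ℓ′ s)) (allFin r))

  expAt-transpose : ∀ q (ℓ : Fin r → ℕ) t → expAt (transpose q ∘ ℓ) a t ≡ expAt ℓ a (transpose q t)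
  expAt-transpose q ℓ t = cong sum (map-cong (λ s → cong (if_then a s else 0) (≡ᵇ-cong (mk⇔
    (λ e → trans (sym (transpose-involutive q (ℓ s))) (cong (transpose q) e))
    (λ e → trans (cong (transpose q) e) (transpose-involutive q t))))) (allFin r))

  expAt-absent : ∀ {ℓ : Fin r → ℕ} {t} → (∀ s → ℓ s ≢ t) → expAt ℓ a t ≡ 0
  expAt-absent {ℓ} {t} absent = sum-zero (allFin r)
    where
    sum-zero : ∀ ss → sum (map (λ s → if ℓ s ≡ᵇ t then a s else 0) ss) ≡ 0
    sum-zero []       = refl
    sum-zero (s ∷ ss) with ℓ s ≡ᵇ t in ℓs≡ᵇt
    ... | true  = contradiction (ℕP.≡ᵇ⇒≡ (ℓ s) t (subst T (sym ℓs≡ᵇt) _)) (absent s)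
    ... | false = sum-zero ss

module _ {d : ℕ} (n : Fin (suc d) → ℕ) (m : Fin d) (g : Monomial d) {r : ℕ} (a : Fin r → ℕ) where
  open Slices n m

  setPart-m : ∀ ℓ t → setPart g m ℓ a m t ≡ expAt ℓ a t
  setPart-m ℓ t with m F.≟ m
  ... | yes _   = refl
  ... | no m≢m  = contradiction refl m≢m

  setPart-≢ : ∀ ℓ {k} → k ≢ m → ∀ t → setPart g m ℓ a k t ≡ g k t
  setPart-≢ ℓ {k} k≢m t with k F.≟ m
  ... | yes k≡m = contradiction k≡m k≢m
  ... | no _    = refl

  setPart-transposed : ∀ q ℓ → Transposed q (setPart g m ℓ a) (setPart g m (transpose q ∘ ℓ) a)
  setPart-transposed q ℓ =
    (λ k k≢m t → trans (setPart-≢ _ k≢m t) (sym (setPart-≢ _ k≢m t))) ,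
    (λ t → trans (setPart-m _ t) (trans (expAt-transpose a q ℓ t) (sym (setPart-m ℓ (transpose q t)))))

  coeffF-setPart-cong : ∀ {ℓ ℓ′} → ℓ ≗ ℓ′ → coeffF n (setPart g m ℓ a) ≡ coeffF n (setPart g m ℓ′ a)
  coeffF-setPart-cong {ℓ} {ℓ′} ℓ≗ℓ′ = coeffF-cong n same
    where
    same : ∀ k t → setPart g m ℓ a k t ≡ setPart g m ℓ′ a k t
    same k t with k F.≟ m
    ... | yes _ = expAt-cong a ℓ≗ℓ′ t
    ... | no _  = refl

  coeffF-gap : ∀ {ℓ} → StrictIncIn (n (inject₁ m)) ℓ → (gap : Gap ℓ) →
    coeffF n (setPart g m ℓ a) ≡ coeffF n (setPart g m (transpose (Gap.q gap) ∘ ℓ) a)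
  coeffF-gap {ℓ} inc gap = Shift.coeffF-transposed q 1≤q q+1≤N (setPart-transposed q ℓ)
    (trans (setPart-m ℓ q) (expAt-absent a absent))
    where
    open Gap gap
    q+1≤N = subst (_≤ n (inject₁ m)) at-index (proj₂ (proj₂ inc index))

  coeffF-canonical : ∀ fuel {ℓ} → StrictIncIn (n (inject₁ m)) ℓ → weight ℓ ≤ fuel →
    coeffF n (setPart g m ℓ a) ≡ coeffF n (setPart g m canonical a)
  coeffF-canonical fuel inc ℓ≤fuel with canonical-or-gap inc
  coeffF-canonical fuel       inc ℓ≤fuel | inj₁ ℓ≗canonical = coeffF-setPart-cong ℓ≗canonical
  coeffF-canonical zero       inc ℓ≤0    | inj₂ gap =
    contradiction (ℕP.<-≤-trans (transpose-weight inc gap) ℓ≤0) λ ()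
  coeffF-canonical (suc fuel) inc ℓ≤fuel | inj₂ gap = trans (coeffF-gap inc gap)
    (coeffF-canonical fuel (transpose-strictIncIn inc gap) (ℕP.≤-pred (ℕP.<-≤-trans (transpose-weight inc gap) ℓ≤fuel)))

corollary6p10 : (d : ℕ) (n : Fin (ℕ.suc d) → ℕ) → (∀ k → 1 ≤ n k) →
    (m : Fin d) (g : Monomial d) (r : ℕ) (ℓ j a : Fin r → ℕ) →
    StrictIncIn (n (inject₁ m)) ℓ → StrictIncIn (n (inject₁ m)) j → (∀ s → 1 ≤ a s) →
    coeffF n (setPart g m ℓ a) ≡ coeffF n (setPart g m j a)
corollary6p10 d n _ m g r ℓ j a incℓ incj _ = trans
  (coeffF-canonical n m g a (weight ℓ) incℓ ℕP.≤-refl)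
  (sym (coeffF-canonical n m g a (weight j) incj ℕP.≤-refl))
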